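{- Let $G$ be a graph, let $I$ be a vertex of maximum degree in $\mathcal{I}^0_{\mathrm{AR}}(G)$, and let $u,v$ be distinct vertices of $G$. Then $uv\notin E(G)$ if and only if $I_u$ and $I_v$ have a common neighbour $I'\neq I$ in $\mathcal{I}^0_{\mathrm{AR}}(G)$.
   Context: $\mathcal{I}^0_{\mathrm{AR}}(G)$ is the graph whose vertices are all independent sets of $G$ (including the empty set), two being adjacent iff one is obtained from the other by adding or removing a single vertex. Its maximum degree equals $n=|V(G)|$, and for a vertex $I$ of maximum degree the neighbours of $I$ are exactly the sets $I_x:=I\triangle\{x\}$, $x\in V(G)$ (symmetric difference), each of which is an independent set. -}

module Defs where

open import Data.Nat using (ℕ; _≤_)
open import Data.Bool using (Bool; not) renaming (_≟_ to _≟ᵇ_)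
open import Data.Fin using (Fin)
open import Data.Fin.Subset using (Subset; _∈_)
open import Data.Fin.Subset.Properties using (_∈?_)
open import Data.Fin.Properties using (all?; any?)
open import Data.Vec using (Vec; []; _∷_; updateAt)
open import Data.Vec.Properties using (≡-dec)
open import Data.List using (List; []; _∷_; _++_; map; filter; length)
open import Data.Product using (_×_; _,_; ∃-syntax)
open import Relation.Nullary using (¬_; Dec; yes; no)
open import Relation.Nullary.Decidable using (_×-dec_; _→-dec_; ¬?)
open import Relation.Binary.PropositionalEquality using (_≡_)

record Graph (n : ℕ) : Set₁ where
  field
    Adj     : Fin n → Fin n → Set
    sym     : ∀ {x y} → Adj x y → Adj y x
    irrefl  : ∀ {x} → ¬ Adj x x
    Adj?    : ∀ x y → Dec (Adj x y)
open Graph public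

Independent : ∀ {n} → Graph n → Subset n → Set
Independent G I = ∀ x y → x ∈ I → y ∈ I → ¬ Adj G x y

independent? : ∀ {n} (G : Graph n) (I : Subset n) → Dec (Independent G I)
independent? G I =
  all? λ x → all? λ y → (x ∈? I) →-dec ((y ∈? I) →-dec ¬? (Adj? G x y))

toggle : ∀ {n} → Fin n → Subset n → Subset n
toggle x I = updateAt I x not

-- Adjacency in I^0_AR(G): J is obtained from I by adding or removing
-- a single vertex, i.e. J = I △ {x} for some vertex x.
-- (Both endpoints are additionally required to be independent where used.)
ARStep : ∀ {n} → Subset n → Subset n → Set
ARStep {n} I J = ∃[ x ] J ≡ toggle x I

ARStep? : ∀ {n} (I J : Subset n) → Dec (ARStep I J)
ARStep? I J = any? λ x → ≡-dec _≟ᵇ_ J (toggle x I)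

ARAdj : ∀ {n} → Graph n → Subset n → Subset n → Set
ARAdj G I J = Independent G I × Independent G J × ARStep I J

ARAdj? : ∀ {n} (G : Graph n) (I J : Subset n) → Dec (ARAdj G I J)
ARAdj? G I J = independent? G I ×-dec (independent? G J ×-dec ARStep? I J)

allSubsets : ∀ n → List (Subset n)
allSubsets ℕ.zero = [] ∷ []
allSubsets (ℕ.suc n) =
  map (Bool.true ∷_) (allSubsets n) ++ map (Bool.false ∷_) (allSubsets n)

degree : ∀ {n} → Graph n → Subset n → ℕ
degree {n} G I = length (filter (ARAdj? G I) (allSubsets n))

MaxDegreeVertex : ∀ {n} → Graph n → Subset n → Set
MaxDegreeVertex G I = Independent G I × (∀ J → Independent G J → degree G J ≤ degree G I)

-- At a vertex I of maximum degree every I △ {x} is independent: the empty set already has the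
-- n singletons as neighbours, whereas a dependent I △ {x} would leave I with fewer than n.
-- If uv is not an edge, I △ {u, v} is then a common neighbour of I_u and I_v other than I.
-- Conversely, a common neighbour I′ ≠ I of I_u and I_v differs from I both at u and at v,
-- so one of I, I_u, I_v, I′ contains both u and v.
module Submission where

open import Defs
open import Data.Fin using (Fin)
open import Data.Fin.Subset using (Subset)
open import Data.Product using (_×_; ∃-syntax)
open import Relation.Nullary using (¬_)
open import Relation.Binary.PropositionalEquality using (_≡_; _≢_)
open import Function.Bundles using (_⇔_)

open import Data.Bool using (true; false; not)
open import Data.Bool.Properties using (not-involutive; not-¬; ¬-not)
open import Data.Empty using (⊥-elim)
open import Data.Fin using (zero; suc; punchIn; punchOut)
open import Data.Fin.Properties using (_≟_; injective⇒≤; punchIn-punchOut)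
open import Data.Fin.Subset using (_∈_; _∉_; ⊥)
open import Data.Fin.Subset.Properties using (_∈?_; ∉⊥)
open import Data.List using (List; lookup; length; map; filter)
open import Data.List.Membership.Propositional using () renaming (_∈_ to _∈ₗ_)
open import Data.List.Membership.Propositional.Properties
  using (∈-lookup; ∈-map⁺; ∈-map⁻; ∈-++⁺ˡ; ∈-++⁺ʳ; ∈-filter⁺; ∈-filter⁻)
open import Data.List.Relation.Unary.Any using (here; index)
open import Data.List.Relation.Unary.Any.Properties using (lookup-index)
import Data.List.Relation.Unary.All as All
open import Data.List.Relation.Unary.AllPairs using ([]; _∷_)
open import Data.List.Relation.Unary.Unique.Propositional using (Unique)
import Data.List.Relation.Unary.Unique.Propositional.Properties as Unique
open import Data.Nat using (ℕ; _≤_; _<_; s≤s)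
open import Data.Nat.Properties using (≤-trans; <⇒≱)
open import Data.Product using (_,_; proj₁; proj₂)
open import Data.Sum using (_⊎_; inj₁; inj₂)
import Data.Vec as Vec
open import Data.Vec.Properties
  using (∷-injectiveʳ; lookup∘updateAt; lookup∘updateAt′; lookup⇒[]=; updateAt-updates;
         updateAt-minimal; updateAt-updateAt-local; updateAt-id; updateAt-commutes)
open import Function using (_∘_)
open import Function.Bundles using (mk⇔)
open import Function.Definitions using (Injective)
open import Relation.Binary.PropositionalEquality
  using (refl; trans; cong; subst; module ≡-Reasoning)
import Relation.Binary.PropositionalEquality as ≡
open import Relation.Nullary using (yes; no; contradiction)
open import Relation.Nullary.Decidable using (decidable-stable)

module _ {n : ℕ} where

  toggle-involutive : ∀ (x : Fin n) K → toggle x (toggle x K) ≡ K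
  toggle-involutive x K =
    trans (updateAt-updateAt-local x K (not-involutive (Vec.lookup K x))) (updateAt-id x K)

  toggle-comm : ∀ {x y : Fin n} → x ≢ y → ∀ K → toggle x (toggle y K) ≡ toggle y (toggle x K)
  toggle-comm {x} {y} x≢y = updateAt-commutes x y x≢y

  ∉⇒∈-toggle : ∀ {x : Fin n} {K} → x ∉ K → x ∈ toggle x K
  ∉⇒∈-toggle {x} {K} x∉K = updateAt-updates x K (lookup⇒[]= x K (¬-not (x∉K ∘ lookup⇒[]= x K)))

  ∈-toggle⁺ : ∀ {x y : Fin n} {K} → y ≢ x → y ∈ K → y ∈ toggle x K
  ∈-toggle⁺ {x} {y} {K} y≢x = updateAt-minimal y x K y≢x

  ∈-toggle⁻ : ∀ {x y : Fin n} {K} → y ≢ x → y ∈ toggle x K → y ∈ K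
  ∈-toggle⁻ {x} {K = K} y≢x y∈ = subst (_ ∈_) (toggle-involutive x K) (∈-toggle⁺ y≢x y∈)

  ∈-toggle-⊥ : ∀ {x y : Fin n} → y ∈ toggle x ⊥ → y ≡ x
  ∈-toggle-⊥ {x} {y} y∈ = decidable-stable (y ≟ x) (λ y≢x → ∉⊥ (∈-toggle⁻ y≢x y∈))

  toggle-⊥-injective : Injective _≡_ _≡_ (λ (x : Fin n) → toggle x ⊥)
  toggle-⊥-injective {x} eq = ∈-toggle-⊥ (subst (x ∈_) eq (∉⇒∈-toggle ∉⊥))

  toggle₂-≢ : ∀ {x y : Fin n} → y ≢ x → ∀ K → toggle x (toggle y K) ≢ K
  toggle₂-≢ {x} {y} y≢x K eq = not-¬ refl (begin
    Vec.lookup K y                       ≡⟨ cong (λ L → Vec.lookup L y) eq ⟨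
    Vec.lookup (toggle x (toggle y K)) y ≡⟨ lookup∘updateAt′ y x y≢x (toggle y K) ⟩
    Vec.lookup (toggle y K) y            ≡⟨ lookup∘updateAt y K ⟩
    not (Vec.lookup K y)                 ∎)
    where open ≡-Reasoning

  ∉⇒∈-toggle-of-toggle : ∀ {x u : Fin n} {K L} → L ≡ toggle x (toggle u K) → L ≢ K → u ∉ K → u ∈ L
  ∉⇒∈-toggle-of-toggle {u = u} {K} refl L≢K u∉K =
    ∈-toggle⁺ (λ { refl → L≢K (toggle-involutive u K) }) (∉⇒∈-toggle u∉K)

module _ {n : ℕ} (G : Graph n) where

  ⊥-independent : Independent G ⊥
  ⊥-independent x _ x∈⊥ _ _ = ∉⊥ x∈⊥

  toggle-⊥-independent : ∀ x → Independent G (toggle x ⊥)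
  toggle-⊥-independent x a b a∈ b∈ with ∈-toggle-⊥ a∈ | ∈-toggle-⊥ b∈
  ... | refl | refl = irrefl G

  adjacent-avoids : ∀ {u v a b} → u ≢ v → ¬ Adj G u v → Adj G a b →
                    (a ≢ v × b ≢ v) ⊎ (a ≢ u × b ≢ u)
  adjacent-avoids {v = v} {a} {b} u≢v ¬uv ab with a ≟ v | b ≟ v
  ... | no a≢v  | no b≢v  = inj₁ (a≢v , b≢v)
  ... | yes refl | yes refl = ⊥-elim (irrefl G ab)
  ... | yes refl | no _    = inj₂ (u≢v ∘ ≡.sym , λ { refl → ¬uv (sym G ab) })
  ... | no _    | yes refl = inj₂ ((λ { refl → ¬uv ab }) , u≢v ∘ ≡.sym)

  toggle₂-independent : ∀ {u v} {K} → u ≢ v → ¬ Adj G u v →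
                        Independent G (toggle u K) → Independent G (toggle v K) →
                        Independent G (toggle v (toggle u K))
  toggle₂-independent {u} {v} {K} u≢v ¬uv indU indV a b a∈ b∈ ab
    with adjacent-avoids u≢v ¬uv ab
  ... | inj₁ (a≢v , b≢v) = indU a b (∈-toggle⁻ a≢v a∈) (∈-toggle⁻ b≢v b∈) ab
  ... | inj₂ (a≢u , b≢u) = indV a b (∈-toggle⁻ a≢u (swap a∈)) (∈-toggle⁻ b≢u (swap b∈)) ab
    where
    swap : ∀ {x} → x ∈ toggle v (toggle u K) → x ∈ toggle u (toggle v K)
    swap = subst (_ ∈_) (toggle-comm (u≢v ∘ ≡.sym) K)

  ¬Adj⇒common-neighbour : ∀ {I} → (∀ x → Independent G (toggle x I)) → ∀ {u v} → u ≢ v →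
                          ¬ Adj G u v →
                          ∃[ I′ ] (I′ ≢ I × ARAdj G (toggle u I) I′ × ARAdj G (toggle v I) I′)
  ¬Adj⇒common-neighbour {I} ind {u} {v} u≢v ¬uv =
    toggle v (toggle u I) , toggle₂-≢ u≢v I ,
    (ind u , indJ , v , refl) , (ind v , indJ , u , toggle-comm (u≢v ∘ ≡.sym) I)
    where
    indJ = toggle₂-independent u≢v ¬uv (ind u) (ind v)

  common-neighbour⇒¬Adj : ∀ {I} → Independent G I → ∀ {u v} → u ≢ v →
                          ∃[ I′ ] (I′ ≢ I × ARAdj G (toggle u I) I′ × ARAdj G (toggle v I) I′) →
                          ¬ Adj G u v
  common-neighbour⇒¬Adj {I} indI {u} {v} u≢v
    (I′ , I′≢I , (indU , indI′ , _ , I′≡Iu△) , (indV , _ , _ , I′≡Iv△)) uv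
    with u ∈? I | v ∈? I
  ... | yes u∈I | yes v∈I = indI u v u∈I v∈I uv
  ... | yes u∈I | no v∉I  = indV u v (∈-toggle⁺ u≢v u∈I) (∉⇒∈-toggle v∉I) uv
  ... | no u∉I  | yes v∈I = indU u v (∉⇒∈-toggle u∉I) (∈-toggle⁺ (u≢v ∘ ≡.sym) v∈I) uv
  ... | no u∉I  | no v∉I  = indI′ u v (∉⇒∈-toggle-of-toggle I′≡Iu△ I′≢I u∉I)
                                      (∉⇒∈-toggle-of-toggle I′≡Iv△ I′≢I v∉I) uv

module _ {a} {A : Set a} where

  lookup-injective : ∀ {xs : List A} → Unique xs → Injective _≡_ _≡_ (lookup xs)
  lookup-injective (_ ∷ _)   {zero}  {zero}  _  = refl
  lookup-injective (x≢ ∷ _)  {zero}  {suc j} eq = contradiction eq (All.lookup x≢ (∈-lookup j))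
  lookup-injective (x≢ ∷ _)  {suc i} {zero}  eq = contradiction (≡.sym eq) (All.lookup x≢ (∈-lookup i))
  lookup-injective (_ ∷ xs!) {suc i} {suc j} eq = cong suc (lookup-injective xs! eq)

  injective⇒≤-length : ∀ {m} {xs : List A} (f : Fin m → A) → Injective _≡_ _≡_ f →
                       (∀ k → f k ∈ₗ xs) → m ≤ length xs
  injective⇒≤-length {xs = xs} f f-inj f∈xs = injective⇒≤ (λ {k} {l} eq → f-inj (begin
    f k                        ≡⟨ lookup-index (f∈xs k) ⟩
    lookup xs (index (f∈xs k)) ≡⟨ cong (lookup xs) eq ⟩
    lookup xs (index (f∈xs l)) ≡⟨ lookup-index (f∈xs l) ⟨
    f l                        ∎))
    where open ≡-Reasoning

  unique-cover⇒length≤ : ∀ {m} {xs : List A} (f : Fin m → A) → Unique xs →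
                         (∀ {y} → y ∈ₗ xs → ∃[ k ] y ≡ f k) → length xs ≤ m
  unique-cover⇒length≤ {xs = xs} f xs! cover =
    injective⇒≤ (λ {i} {j} eq → lookup-injective xs! (begin
      lookup xs i ≡⟨ proj₂ (cover (∈-lookup i)) ⟩
      f (code i)  ≡⟨ cong f eq ⟩
      f (code j)  ≡⟨ proj₂ (cover (∈-lookup j)) ⟨
      lookup xs j ∎))
    where
    open ≡-Reasoning
    code : Fin (length xs) → Fin _
    code i = proj₁ (cover (∈-lookup i))

∈-allSubsets : ∀ {n} (K : Subset n) → K ∈ₗ allSubsets n
∈-allSubsets Vec.[] = here refl
∈-allSubsets {ℕ.suc n} (true Vec.∷ K) = ∈-++⁺ˡ (∈-map⁺ (true Vec.∷_) (∈-allSubsets K))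
∈-allSubsets {ℕ.suc n} (false Vec.∷ K) =
  ∈-++⁺ʳ (map (true Vec.∷_) (allSubsets n)) (∈-map⁺ (false Vec.∷_) (∈-allSubsets K))

allSubsets-unique : ∀ n → Unique (allSubsets n)
allSubsets-unique ℕ.zero = All.[] ∷ []
allSubsets-unique (ℕ.suc n) =
  Unique.++⁺ (Unique.map⁺ ∷-injectiveʳ (allSubsets-unique n))
             (Unique.map⁺ ∷-injectiveʳ (allSubsets-unique n)) disjoint
  where
  disjoint : ∀ {K} →
             ¬ (K ∈ₗ map (true Vec.∷_) (allSubsets n) × K ∈ₗ map (false Vec.∷_) (allSubsets n))
  disjoint (K∈ₜ , K∈f) with ∈-map⁻ (true Vec.∷_) K∈ₜ | ∈-map⁻ (false Vec.∷_) K∈f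
  ... | _ , _ , refl | _ , _ , ()

n≤degree-⊥ : ∀ {n} (G : Graph n) → n ≤ degree G ⊥
n≤degree-⊥ G = injective⇒≤-length (λ x → toggle x ⊥) toggle-⊥-injective λ x →
  ∈-filter⁺ (ARAdj? G ⊥) (∈-allSubsets _) (⊥-independent G , toggle-⊥-independent G x , x , refl)

dependent-toggle⇒degree<n : ∀ {n} (G : Graph n) {I} x →
                            ¬ Independent G (toggle x I) → degree G I < n
dependent-toggle⇒degree<n {n@(ℕ.suc _)} G {I} x ¬ind =
  s≤s (unique-cover⇒length≤ (λ k → toggle (punchIn x k) I)
                            (Unique.filter⁺ (ARAdj? G I) (allSubsets-unique n)) cover)
  where
  cover : ∀ {J} → J ∈ₗ filter (ARAdj? G I) (allSubsets n) → ∃[ k ] J ≡ toggle (punchIn x k) I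
  cover J∈ with ∈-filter⁻ (ARAdj? G I) {xs = allSubsets n} J∈
  ... | _ , _ , indJ , y , refl =
    punchOut x≢y , cong (λ z → toggle z I) (≡.sym (punchIn-punchOut x≢y))
    where
    x≢y : x ≢ y
    x≢y refl = ¬ind indJ

maxDegree⇒toggle-independent : ∀ {n} (G : Graph n) {I} → MaxDegreeVertex G I →
                               ∀ x → Independent G (toggle x I)
maxDegree⇒toggle-independent G (_ , maximal) x = decidable-stable (independent? G _) λ ¬ind →
  <⇒≱ (dependent-toggle⇒degree<n G x ¬ind) (≤-trans (n≤degree-⊥ G) (maximal ⊥ (⊥-independent G)))

lemma4p2 : ∀ {n} (G : Graph n) (I : Subset n) → MaxDegreeVertex G I →
           (u v : Fin n) → u ≢ v →
           (¬ Adj G u v) ⇔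
           (∃[ I′ ] (I′ ≢ I × ARAdj G (toggle u I) I′ × ARAdj G (toggle v I) I′))
lemma4p2 G I maxI u v u≢v =
  mk⇔ (¬Adj⇒common-neighbour G (maxDegree⇒toggle-independent G maxI) u≢v)
      (common-neighbour⇒¬Adj G (proj₁ maxI) u≢v)
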